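{- Let $\phi(\bar x,\bar w)\in\mathcal A$ be a semiformula whose numeric variables are exactly $\bar x$ and table variables exactly $\bar w$. If for terms $\bar a$ (without unknowns) the formula $\phi(\bar a,\bar\ast)$ is solvable, where $\bar\ast$ are pairwise distinct unknowns, then each term of $\bar a$ is a $0$-numeral $S^m(0)$.
   Context: First-order predicate calculus with identity $\doteq$, over a language with countably many variables and countably infinitely many function and predicate symbols of every arity; terms are variable-free; $\models\theta$ means $\theta$ is true in every structure. An infinite set of distinguished constants, called unknowns, is singled out. A quantifier-free formula $\phi(\bar\ast)$ (unknowns among $\bar\ast$) is solvable if there are terms $\bar a$ without unknowns with $\models\phi(\bar a)$. $S^0(t)=t$, $S^{m+1}(t)=S(S^m(t))$. The language $P$: distinct constants $0,\hat 0,\tilde 0,k,\tilde k$ (not unknowns), unary $S$, binary $\mathrm{pr}$. Define: $\mathit{Num}(x)$: $0\doteq S(0)\to 0\doteq x$; $\widetilde{\mathit{Num}}(x)$: $\tilde0\doteq S(\tilde0)\to\tilde0\doteq x$; $\mathit{Sim}(x,y)$: $0\doteq\tilde0\to x\doteq y$; $\mathit{Plus}(x,y,z)$: $\tilde0\doteq x\to z\doteq y$; $\mathit{Add}(x,y,z,w)$: $\widetilde{\mathit{Num}}(w)\wedge\mathit{Sim}(y,w)\wedge\mathit{Plus}(x,w,z)$; $\mathit{Tab}(x)$: $0\doteq S(0)\wedge k\doteq\mathrm{pr}(\mathrm{pr}(0,0),k)\to k\doteq x$; $\widetilde{\mathit{Tab}}(x)$: $\hat0\doteq S(\hat0)\wedge\tilde0\doteq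 S(\tilde0)\wedge\tilde k\doteq\mathrm{pr}(\mathrm{pr}(\hat0,\tilde0),\tilde k)\to\tilde k\doteq x$; $\widetilde{\mathit{Sim}}(x,y)$: $0\doteq\hat0\wedge0\doteq\tilde0\wedge k\doteq\tilde k\to x\doteq y$; $\mathit{Tim}(x,y,z,w,\tilde w)$: $\hat0\doteq S(0)\wedge\tilde0\doteq x\wedge\tilde k\doteq\mathrm{pr}(\mathrm{pr}(0,0),k)\to\tilde w\doteq\mathrm{pr}(\mathrm{pr}(y,z),w)$; $\mathit{Mul}(x,y,z,w,\tilde w)$: $\mathit{Tab}(w)\wedge\widetilde{\mathit{Tab}}(\tilde w)\wedge\widetilde{\mathit{Sim}}(w,\tilde w)\wedge\mathit{Tim}(x,y,z,w,\tilde w)$. A diophantine semiformula is a conjunction of atomic formulas $a+b\doteq c$ and $a\cdot b\doteq c$ of the language $\{0,S,+,\cdot\}$ where each of $a,b,c$ is a variable or a $0$-numeral. Variables are split into two disjoint infinite sets: numeric variables (those used in diophantine semiformulas) and table variables. Association: $a+b\doteq c$ is associated with any $\mathit{Num}(a)\wedge\mathit{Num}(b)\wedge\mathit{Num}(c)\wedge\mathit{Add}(a,b,c,w)$ ($w$ a table variable); $a\cdot b\doteq c$ with any $\mathit{Num}(a)\wedge\mathit{Num}(b)\wedge\mathit{Num}(c)\wedge\mathit{Mul}(a,b,c,w_1,w_2)$ ($w_1,w_2$ distinct table variables); $\psi_1\wedge\psi_2$ with any $\phi_1\wedge\phi_2$ where $\psi_j$ is associated with $\phi_j$ and $\phi_1,\phi_2$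 have disjoint table variables. $\mathcal A$ is the class of all semiformulas of $P$ associated with some diophantine semiformula. -}

module Defs where

open import Data.Nat using (ℕ; zero; suc)
open import Data.Vec using (Vec; []; _∷_)
open import Data.Empty using (⊥)
open import Data.Unit using (⊤)
open import Data.Bool using (Bool; true; false; _∨_; not) renaming (_∧_ to _&&_)
open import Data.Product using (Σ; _×_; ∃)
open import Relation.Binary.PropositionalEquality using (_≡_; _≢_)
open import Relation.Binary.Definitions using (DecidableEquality)
open import Relation.Nullary.Decidable using (⌊_⌋)

-- Constants of P: 0, 0^, 0~, k, k~; infinitely many unknowns;
-- S (unary), pr (binary); plus countably many further symbols of every arity.

data FunSym : ℕ → Set where
  c0 c0^ c0~ ck ck~ : FunSym 0
  unknown : ℕ → FunSym 0
  sS : FunSym 1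
  sPr : FunSym 2
  other : (n i : ℕ) → FunSym n

data Tm (V : Set) : Set where
  var : V → Tm V
  app : ∀ {n} → FunSym n → Vec (Tm V) n → Tm V

Term : Set
Term = Tm ⊥

-- Quantifier-free formulas (only identity; P has no predicate symbols).
infix  7 _≐_
infixr 6 _∧f_
infixr 6 _∨f_
infixr 5 _⇒_
data Fm (V : Set) : Set where
  _≐_ : Tm V → Tm V → Fm V
  ⊥f  : Fm V
  _∧f_ _∨f_ _⇒_ : Fm V → Fm V → Fm V
  ¬f  : Fm V → Fm V

mapFm : ∀ {V W : Set} → (Tm V → Tm W) → Fm V → Fm W
mapFm f (t ≐ s) = f t ≐ f s
mapFm f ⊥f = ⊥f
mapFm f (φ ∧f ψ) = mapFm f φ ∧f mapFm f ψ
mapFm f (φ ∨f ψ) = mapFm f φ ∨f mapFm f ψ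
mapFm f (φ ⇒ ψ) = mapFm f φ ⇒ mapFm f ψ
mapFm f (¬f φ) = ¬f (mapFm f φ)

mutual
  subst : ∀ {V W : Set} → (V → Tm W) → Tm V → Tm W
  subst ρ (var v) = ρ v
  subst ρ (app f ts) = app f (substV ρ ts)

  substV : ∀ {V W : Set} {n} → (V → Tm W) → Vec (Tm V) n → Vec (Tm W) n
  substV ρ [] = []
  substV ρ (t ∷ ts) = subst ρ t ∷ substV ρ ts

mutual
  substU : (ℕ → Term) → Term → Term
  substU σ (var ())
  substU σ (app (unknown i) []) = σ i
  substU σ (app c0 ts) = app c0 (substUV σ ts)
  substU σ (app c0^ ts) = app c0^ (substUV σ ts)
  substU σ (app c0~ ts) = app c0~ (substUV σ ts)
  substU σ (app ck ts) = app ck (substUV σ ts)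
  substU σ (app ck~ ts) = app ck~ (substUV σ ts)
  substU σ (app sS ts) = app sS (substUV σ ts)
  substU σ (app sPr ts) = app sPr (substUV σ ts)
  substU σ (app (other n i) ts) = app (other n i) (substUV σ ts)

  substUV : ∀ {n} → (ℕ → Term) → Vec Term n → Vec Term n
  substUV σ [] = []
  substUV σ (t ∷ ts) = substU σ t ∷ substUV σ ts

IsUnknown : ∀ {n} → FunSym n → Set
IsUnknown (unknown i) = ⊤
IsUnknown _ = ⊥

mutual
  data NoUnk {V : Set} : Tm V → Set where
    var : (v : V) → NoUnk (var v)
    app : ∀ {n} {f : FunSym n} {ts : Vec (Tm V) n} →
          (IsUnknown f → ⊥) → NoUnkV ts → NoUnk (app f ts)

  data NoUnkV {V : Set} : ∀ {n} → Vec (Tm V) n → Set where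
    []  : NoUnkV []
    _∷_ : ∀ {n} {t : Tm V} {ts : Vec (Tm V) n} → NoUnk t → NoUnkV ts → NoUnkV (t ∷ ts)

mutual
  data Occ {V : Set} (v : V) : Tm V → Set where
    here : Occ v (var v)
    inApp : ∀ {n} {f : FunSym n} {ts : Vec (Tm V) n} → OccV v ts → Occ v (app f ts)

  data OccV {V : Set} (v : V) : ∀ {n} → Vec (Tm V) n → Set where
    hd : ∀ {n} {t : Tm V} {ts : Vec (Tm V) n} → Occ v t → OccV v (t ∷ ts)
    tl : ∀ {n} {t : Tm V} {ts : Vec (Tm V) n} → OccV v ts → OccV v (t ∷ ts)

data OccF {V : Set} (v : V) : Fm V → Set where
  eqL  : ∀ {t s} → Occ v t → OccF v (t ≐ s)
  eqR  : ∀ {t s} → Occ v s → OccF v (t ≐ s)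
  andL : ∀ {φ ψ} → OccF v φ → OccF v (φ ∧f ψ)
  andR : ∀ {φ ψ} → OccF v ψ → OccF v (φ ∧f ψ)
  orL  : ∀ {φ ψ} → OccF v φ → OccF v (φ ∨f ψ)
  orR  : ∀ {φ ψ} → OccF v ψ → OccF v (φ ∨f ψ)
  impL : ∀ {φ ψ} → OccF v φ → OccF v (φ ⇒ ψ)
  impR : ∀ {φ ψ} → OccF v ψ → OccF v (φ ⇒ ψ)
  neg  : ∀ {φ} → OccF v φ → OccF v (¬f φ)

record Structure : Set₁ where
  field
    Carrier : Set
    _≟_     : DecidableEquality Carrier
    interp  : ∀ {n} → FunSym n → Vec Carrier n → Carrier

module _ (M : Structure) where
  open Structure M

  mutual
    eval : Term → Carrier
    eval (var ())
    eval (app f ts) = interp f (evalV ts)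

    evalV : ∀ {n} → Vec Term n → Vec Carrier n
    evalV [] = []
    evalV (t ∷ ts) = eval t ∷ evalV ts

  truth : Fm ⊥ → Bool
  truth (t ≐ s) = ⌊ eval t ≟ eval s ⌋
  truth ⊥f = false
  truth (φ ∧f ψ) = truth φ && truth ψ
  truth (φ ∨f ψ) = truth φ ∨ truth ψ
  truth (φ ⇒ ψ) = not (truth φ) ∨ truth ψ
  truth (¬f φ) = not (truth φ)

Valid : Fm ⊥ → Set₁
Valid θ = (M : Structure) → truth M θ ≡ true

Solvable : Fm ⊥ → Set₁
Solvable φ = Σ (ℕ → Term) λ σ → ((i : ℕ) → NoUnk (σ i)) × Valid (mapFm (substU σ) φ)

data Var : Set where
  nv : ℕ → Var
  tv : ℕ → Var

module _ {V : Set} where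
  ze z^ z~ kk k~ : Tm V
  ze = app c0 []
  z^ = app c0^ []
  z~ = app c0~ []
  kk = app ck []
  k~ = app ck~ []

  S : Tm V → Tm V
  S t = app sS (t ∷ [])

  pr : Tm V → Tm V → Tm V
  pr t s = app sPr (t ∷ s ∷ [])

  numeral : ℕ → Tm V
  numeral zero = ze
  numeral (suc m) = S (numeral m)

  Num NumT : Tm V → Fm V
  Num x  = ze ≐ S ze ⇒ ze ≐ x
  NumT x = z~ ≐ S z~ ⇒ z~ ≐ x

  Sim : Tm V → Tm V → Fm V
  Sim x y = ze ≐ z~ ⇒ x ≐ y

  Plus : Tm V → Tm V → Tm V → Fm V
  Plus x y z = z~ ≐ x ⇒ z ≐ y

  Add : Tm V → Tm V → Tm V → Tm V → Fm V
  Add x y z w = NumT w ∧f Sim y w ∧f Plus x w z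

  Tab TabT : Tm V → Fm V
  Tab x  = ze ≐ S ze ∧f kk ≐ pr (pr ze ze) kk ⇒ kk ≐ x
  TabT x = z^ ≐ S z^ ∧f z~ ≐ S z~ ∧f k~ ≐ pr (pr z^ z~) k~ ⇒ k~ ≐ x

  SimT : Tm V → Tm V → Fm V
  SimT x y = ze ≐ z^ ∧f ze ≐ z~ ∧f kk ≐ k~ ⇒ x ≐ y

  Tim Mul : Tm V → Tm V → Tm V → Tm V → Tm V → Fm V
  Tim x y z w w' = z^ ≐ S ze ∧f z~ ≐ x ∧f k~ ≐ pr (pr ze ze) kk ⇒ w' ≐ pr (pr y z) w
  Mul x y z w w' = Tab w ∧f TabT w' ∧f SimT w w' ∧f Tim x y z w w'

data DArg : Set where
  dv : ℕ → DArg
  dn : ℕ → DArg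

data Dioph : Set where
  plusD  : DArg → DArg → DArg → Dioph
  timesD : DArg → DArg → DArg → Dioph
  _&D_   : Dioph → Dioph → Dioph

darg : DArg → Tm Var
darg (dv x) = var (nv x)
darg (dn m) = numeral m

DisjointTable : Fm Var → Fm Var → Set
DisjointTable φ₁ φ₂ = (w : ℕ) → OccF (tv w) φ₁ → OccF (tv w) φ₂ → ⊥

data Assoc : Dioph → Fm Var → Set where
  plusA : ∀ a b c (w : ℕ) →
    Assoc (plusD a b c)
      (Num (darg a) ∧f Num (darg b) ∧f Num (darg c) ∧f
       Add (darg a) (darg b) (darg c) (var (tv w)))
  timesA : ∀ a b c (w₁ w₂ : ℕ) → w₁ ≢ w₂ →
    Assoc (timesD a b c)
      (Num (darg a) ∧f Num (darg b) ∧f Num (darg c) ∧f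
       Mul (darg a) (darg b) (darg c) (var (tv w₁)) (var (tv w₂)))
  andA : ∀ {ψ₁ ψ₂ φ₁ φ₂} → Assoc ψ₁ φ₁ → Assoc ψ₂ φ₂ →
    DisjointTable φ₁ φ₂ → Assoc (ψ₁ &D ψ₂) (φ₁ ∧f φ₂)

InA : Fm Var → Set
InA φ = ∃ λ ψ → Assoc ψ φ

inst : (ℕ → Term) → (ℕ → ℕ) → Var → Term
inst a u (nv x) = a x
inst a u (tv w) = app (unknown (u w)) []

module Submission where

-- Evaluate in the two-element structure 𝔹 where the constant 0
-- denotes false, S is the identity and every other symbol denotes true.  There
-- 0 ≐ S(0) holds, so Num(t) is true exactly when t denotes false, and a term
-- without unknowns denotes false only if it is a numeral S^m(0).
--
-- Syntactically, every numeric variable x occurring in φ ∈ 𝒜 is guarded: the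
-- formula Num(x) is one of the conjuncts of φ.  Indeed, an atomic clause of φ
-- is an instance of a fixed pattern Num(x₀) ∧ Num(x₁) ∧ Num(x₂) ∧ R(x₀,x₁,x₂,w̄);
-- a variable occurring in an instance of a pattern occurs in one of the
-- substituted terms, the table slots w̄ hold table variables, and a numeric
-- slot containing x must be x itself (numerals are closed).
--
-- The theorem follows: a solution of φ(ā,∗̄) makes the conjunct Num(a_x) valid,
-- in particular true in 𝔹, so a_x denotes false there and is a numeral.

open import Defs
open import Data.Nat using (ℕ; zero; suc)
open import Data.Fin using (Fin; zero; suc)
open import Data.Vec using (Vec; []; _∷_; lookup)
open import Data.Sum using (_⊎_; inj₁; inj₂)
open import Data.Product using (∃; _,_)
open import Data.Bool using (Bool; true; false)
import Data.Bool as Bool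
open import Data.Bool.Properties using (∧-conicalˡ; ∧-conicalʳ)
open import Data.Empty using (⊥; ⊥-elim)
open import Data.Unit using (tt)
open import Relation.Binary.PropositionalEquality using (_≡_; refl)
open import Relation.Nullary.Decidable using (⌊_⌋)

mutual
  occ-subst : ∀ {U V : Set} (ρ : U → Tm V) {v : V} (t : Tm U) →
              Occ v (subst ρ t) → ∃ λ u → Occ v (ρ u)
  occ-subst ρ (var u) o = u , o
  occ-subst ρ (app f ts) (inApp o) = occV-subst ρ ts o

  occV-subst : ∀ {U V : Set} (ρ : U → Tm V) {v : V} {n} (ts : Vec (Tm U) n) →
               OccV v (substV ρ ts) → ∃ λ u → Occ v (ρ u)
  occV-subst ρ (t ∷ ts) (hd o) = occ-subst ρ t o
  occV-subst ρ (t ∷ ts) (tl o) = occV-subst ρ ts o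

occF-subst : ∀ {U V : Set} (ρ : U → Tm V) {v : V} (φ : Fm U) →
             OccF v (mapFm (subst ρ) φ) → ∃ λ u → Occ v (ρ u)
occF-subst ρ (t ≐ s) (eqL o) = occ-subst ρ t o
occF-subst ρ (t ≐ s) (eqR o) = occ-subst ρ s o
occF-subst ρ (φ ∧f ψ) (andL o) = occF-subst ρ φ o
occF-subst ρ (φ ∧f ψ) (andR o) = occF-subst ρ ψ o
occF-subst ρ (φ ∨f ψ) (orL o) = occF-subst ρ φ o
occF-subst ρ (φ ∨f ψ) (orR o) = occF-subst ρ ψ o
occF-subst ρ (φ ⇒ ψ) (impL o) = occF-subst ρ φ o
occF-subst ρ (φ ⇒ ψ) (impR o) = occF-subst ρ ψ o
occF-subst ρ (¬f φ) (neg o) = occF-subst ρ φ o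

infix 4 _∈∧_
data _∈∧_ {V : Set} (χ : Fm V) : Fm V → Set where
  here  : χ ∈∧ χ
  left  : ∀ {φ ψ} → χ ∈∧ φ → χ ∈∧ (φ ∧f ψ)
  right : ∀ {φ ψ} → χ ∈∧ ψ → χ ∈∧ (φ ∧f ψ)

∈∧-map : ∀ {V W : Set} (f : Tm V → Tm W) {χ φ : Fm V} →
         χ ∈∧ φ → mapFm f χ ∈∧ mapFm f φ
∈∧-map f here = here
∈∧-map f (left c) = left (∈∧-map f c)
∈∧-map f (right c) = right (∈∧-map f c)

∈∧-true : (M : Structure) {χ φ : Fm ⊥} → χ ∈∧ φ → truth M φ ≡ true → truth M χ ≡ true
∈∧-true M here e = e
∈∧-true M (left {φ} {ψ} c) e = ∈∧-true M c (∧-conicalˡ (truth M φ) (truth M ψ) e)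
∈∧-true M (right {φ} {ψ} c) e = ∈∧-true M c (∧-conicalʳ (truth M φ) (truth M ψ) e)

numeral-closed : ∀ {V : Set} {v : V} (m : ℕ) → Occ v (numeral {V} m) → ⊥
numeral-closed zero (inApp ())
numeral-closed (suc m) (inApp (hd o)) = numeral-closed m o
numeral-closed (suc m) (inApp (tl ()))

-- The variables of an atomic clause fill the slots of its pattern: three
-- numeric arguments and n table variables.
Slot : ℕ → Set
Slot n = Fin 3 ⊎ Fin n

fill : ∀ {n} → DArg → DArg → DArg → Vec ℕ n → Slot n → Tm Var
fill a b c ws (inj₁ i) = darg (lookup (a ∷ b ∷ c ∷ []) i)
fill a b c ws (inj₂ j) = var (tv (lookup ws j))

x₀ x₁ x₂ : ∀ {n} → Tm (Slot n)
x₀ = var (inj₁ zero)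
x₁ = var (inj₁ (suc zero))
x₂ = var (inj₁ (suc (suc zero)))

plusPattern : Fm (Slot 1)
plusPattern = Num x₀ ∧f Num x₁ ∧f Num x₂ ∧f Add x₀ x₁ x₂ (var (inj₂ zero))

timesPattern : Fm (Slot 2)
timesPattern = Num x₀ ∧f Num x₁ ∧f Num x₂ ∧f
               Mul x₀ x₁ x₂ (var (inj₂ zero)) (var (inj₂ (suc zero)))

guardedArg : ∀ {x} (d : DArg) → Occ (nv x) (darg d) → Num (var (nv x)) ∈∧ Num (darg d)
guardedArg (dv y) here = here
guardedArg (dn m) o = ⊥-elim (numeral-closed m o)

guardedSlot : ∀ {n x} (a b c : DArg) (ws : Vec ℕ n) (R : Fm Var) (s : Slot n) →
              Occ (nv x) (fill a b c ws s) →
              Num (var (nv x)) ∈∧ (Num (darg a) ∧f Num (darg b) ∧f Num (darg c) ∧f R)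
guardedSlot a b c ws R (inj₁ zero) o = left (guardedArg a o)
guardedSlot a b c ws R (inj₁ (suc zero)) o = right (left (guardedArg b o))
guardedSlot a b c ws R (inj₁ (suc (suc zero))) o = right (right (left (guardedArg c o)))
guardedSlot a b c ws R (inj₂ j) ()

guarded : ∀ {ψ φ x} → Assoc ψ φ → OccF (nv x) φ → Num (var (nv x)) ∈∧ φ
guarded (plusA a b c w) o with occF-subst (fill a b c (w ∷ [])) plusPattern o
... | s , o′ = guardedSlot a b c (w ∷ []) _ s o′
guarded (timesA a b c w₁ w₂ _) o with occF-subst (fill a b c (w₁ ∷ w₂ ∷ [])) timesPattern o
... | s , o′ = guardedSlot a b c (w₁ ∷ w₂ ∷ []) _ s o′
guarded (andA A₁ A₂ _) (andL o) = left (guarded A₁ o)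
guarded (andA A₁ A₂ _) (andR o) = right (guarded A₂ o)

interp𝔹 : ∀ {n} → FunSym n → Vec Bool n → Bool
interp𝔹 c0 [] = false
interp𝔹 sS (b ∷ []) = b
interp𝔹 _ _ = true

𝔹 : Structure
𝔹 = record { Carrier = Bool ; _≟_ = Bool._≟_ ; interp = interp𝔹 }

-- In 𝔹 the premise 0 ≐ S(0) holds, so Num(t) says that t denotes false.
Num-true : (t : Term) → truth 𝔹 (Num t) ≡ true → eval 𝔹 t ≡ false
Num-true t e with eval 𝔹 t
... | false = refl
Num-true t () | true

false-numeral : (σ : ℕ → Term) (t : Term) → NoUnk t →
                eval 𝔹 (substU σ t) ≡ false → ∃ λ m → t ≡ numeral m
false-numeral σ (app c0 []) _ _ = zero , refl
false-numeral σ (app sS (t ∷ [])) (app _ (nt ∷ [])) e with false-numeral σ t nt e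
... | m , refl = suc m , refl
false-numeral σ (app (unknown i) []) (app notUnknown _) _ = ⊥-elim (notUnknown tt)
false-numeral σ (app c0^ []) _ ()
false-numeral σ (app c0~ []) _ ()
false-numeral σ (app ck []) _ ()
false-numeral σ (app ck~ []) _ ()
false-numeral σ (app sPr (t ∷ s ∷ [])) _ ()
false-numeral σ (app (other n i) ts) _ ()

lemma4p6 : (φ : Fm Var) → InA φ →
    (a : ℕ → Term) → (u : ℕ → ℕ) →
    ((x : ℕ) → OccF (nv x) φ → NoUnk (a x)) →
    ((w w' : ℕ) → OccF (tv w) φ → OccF (tv w') φ → u w ≡ u w' → w ≡ w') →
    Solvable (mapFm (subst (inst a u)) φ) →
    (x : ℕ) → OccF (nv x) φ → ∃ λ m → a x ≡ numeral m
lemma4p6 φ (_ , A) a u noUnk _ (σ , _ , valid) x o =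
  false-numeral σ (a x) (noUnk x o) (Num-true (substU σ (a x)) numTrue)
  where
  numTrue : truth 𝔹 (Num (substU σ (a x))) ≡ true
  numTrue = ∈∧-true 𝔹 (∈∧-map (substU σ) (∈∧-map (subst (inst a u)) (guarded A o))) (valid 𝔹)
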